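{- There exists a positive integer $n_0$ such that for all integers $n\geq n_0$, $$\frac{g(6n-2)}{g(6n-4)}>\frac{g(6n)}{g(6n-2)}>\frac{g(6n+2)}{g(6n)}<\frac{g(6n+4)}{g(6n+2)}.$$
   Context: For a positive integer $m$, $g(m)$ denotes the number of nonempty subsets $A\subseteq\{1,2,\dots,m\}$ such that $\gcd(A)>1$ and $\gcd(A\cup\{m+1\})=1$, where $\gcd$ of a finite set of positive integers is the greatest common divisor of all its elements. -}

module Defs where

open import Data.Nat using (ℕ; zero; suc; _+_; _≟_)
open import Data.Nat.GCD using (gcd)
open import Data.List using (List; []; _∷_; map; foldr; length; filter; _++_)
open import Data.List.Base using (upTo)
open import Data.Product using (_×_)
open import Data.Bool using (Bool; true; false; _∧_; not)
open import Relation.Nullary.Decidable using (⌊_⌋; _×-dec_; ¬?)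
open import Data.Nat using (_<?_; _>_)
open import Relation.Unary using (Decidable)

-- gcd of a finite set (given as a list of its elements); gcd of [] is 0
gcdList : List ℕ → ℕ
gcdList = foldr gcd 0

subsets : List ℕ → List (List ℕ)
subsets [] = [] ∷ []
subsets (x ∷ xs) = let s = subsets xs in s ++ map (x ∷_) s

range1 : ℕ → List ℕ
range1 m = map suc (upTo m)

nonEmpty : List ℕ → Bool
nonEmpty [] = false
nonEmpty (_ ∷ _) = true

-- A is counted iff A nonempty, gcd(A) > 1, gcd(A ∪ {m+1}) = 1
good : ℕ → List ℕ → Bool
good m A = nonEmpty A ∧ ⌊ 1 <? gcdList A ⌋ ∧ ⌊ gcd (gcdList A) (suc m) ≟ 1 ⌋

g : ℕ → ℕ
g m = length (filter (λ A → Data.Bool.T? (good m A)) (subsets (range1 m)))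

{-# OPTIONS --safe #-}
module Submission where

-- Write N = m + 1 and G = gcd A.  A set counted by g(m) has G > 1 and gcd(G, N) = 1, so either
-- 2 ∣ G, or 3 ∣ G and 3 ∤ N, or G has a divisor e ≥ 5 (necessarily e ≤ m).  Conversely, if 2 ∤ N
-- and 3 ∤ N, a nonempty set of multiples of 2 or of 3 fails to be counted only if gcd(G, N) ≥ 5
-- divides G.  Since exactly 2^⌊m/d⌋ subsets of {1,…,m} consist of multiples of d, inclusion-exclusion
-- gives g(m) = 2^⌊m/2⌋ + [3 ∤ N] 2^⌊m/3⌋ + O(2^⌊m/6⌋ + m 2^⌊m/5⌋), the lower bound needing 2 ∤ N and
-- 3 ∤ N.  For m = 6k + r with r = 2, 4, …, 10 and X = 2^k the main terms are α X³ + β X², while the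
-- error is at most X²/4 once k ≥ 22; after multiplying out, each of the three comparisons is then
-- decided by the X⁵ coefficients.

open import Defs
open import Data.Bool.Base using (Bool; true; false; _∧_; _∨_; not; T)
open import Data.Bool.Properties using (T?; T-∧; T-∨; T-not-≡)
open import Data.Empty using (⊥-elim)
open import Data.Bool.ListAction using (all; any)
open import Data.List.Base using (List; []; _∷_; _++_; [_]; map; length; filter; null; upTo)
open import Data.List.Properties using (map-++; upTo-∷ʳ; length-map; length-upTo)
open import Data.List.Membership.Propositional using (_∈_; lose)
open import Data.List.Membership.Propositional.Properties using (∈-map⁺; ∈-map⁻; ∈-upTo⁺; ∈-upTo⁻)
open import Data.List.Relation.Unary.All as All using (All; []; _∷_)
open import Data.List.Relation.Unary.All.Properties using (all⁺; all⁻; ++⁺; map⁺)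
open import Data.List.Relation.Unary.Any.Properties using (any⁺)
open import Data.Nat
open import Data.Nat.Properties
open import Data.Nat.DivMod using (_/_; _%_; m≡m%n+[m/n]*n; m%n<n; m*n/n≡m; +-distrib-/-∣ʳ; /-monoʳ-≤; /-monoˡ-≤; m/n*n≤m)
open import Data.Nat.Divisibility
open import Data.Nat.GCD using (gcd; gcd[m,n]∣m; gcd[m,n]∣n; gcd-greatest; gcd[m,n]≡0⇒m≡0)
open import Data.Nat.LCM using (lcm-least)
open import Data.Nat.Tactic.RingSolver using (solve-∀)
open import Data.Product using (Σ; _×_; _,_; proj₁; proj₂)
open import Data.Sum using (_⊎_; inj₁; inj₂)
open import Function.Base using (_∘_; case_of_)
open import Function.Bundles using (Equivalence)
open import Relation.Nullary using (¬_; yes; no; does)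
open import Relation.Nullary.Decidable using (toWitness; fromWitness; dec-true; dec-false; from-yes; from-no)
open import Relation.Binary.PropositionalEquality hiding ([_])

-- Counting with Boolean predicates

T-∨⁺ˡ : ∀ {a} b → T a → T (a ∨ b)
T-∨⁺ˡ {true} b _ = _

T-∨⁺ʳ : ∀ a {b} → T b → T (a ∨ b)
T-∨⁺ʳ true  _  = _
T-∨⁺ʳ false tb = tb

indicator : Bool → ℕ
indicator true  = 1
indicator false = 0

private
  variable
    A B : Set

count : (A → Bool) → List A → ℕ
count p []       = 0
count p (x ∷ xs) = indicator (p x) + count p xs

length-filter≡count : ∀ (p : A → Bool) xs → length (filter (T? ∘ p) xs) ≡ count p xs
length-filter≡count p []       = refl
length-filter≡count p (x ∷ xs) with p x
... | true  = cong suc (length-filter≡count p xs)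
... | false = length-filter≡count p xs

count-false : ∀ (xs : List A) → count (λ _ → false) xs ≡ 0
count-false []       = refl
count-false (x ∷ xs) = count-false xs

count-++ : ∀ (p : A → Bool) xs ys → count p (xs ++ ys) ≡ count p xs + count p ys
count-++ p []       ys = refl
count-++ p (x ∷ xs) ys = trans (cong (indicator (p x) +_) (count-++ p xs ys)) (sym (+-assoc (indicator (p x)) _ _))

count-map : ∀ (p : A → Bool) (f : B → A) xs → count p (map f xs) ≡ count (p ∘ f) xs
count-map p f []       = refl
count-map p f (x ∷ xs) = cong (indicator (p (f x)) +_) (count-map p f xs)

count-∧ˡ : ∀ b (p : A → Bool) xs → count (λ x → b ∧ p x) xs ≡ indicator b * count p xs
count-∧ˡ true  p xs = sym (+-identityʳ (count p xs))
count-∧ˡ false p xs = count-false xs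

indicator-*-≤ : ∀ {b x y} → (T b → x ≤ y) → indicator b * x ≤ y
indicator-*-≤ {true}  {x} x≤y = ≤-trans (≤-reflexive (+-identityʳ x)) (x≤y _)
indicator-*-≤ {false}     _   = z≤n

count-mono : ∀ {p q : A → Bool} xs → All (λ x → T (p x) → T (q x)) xs → count p xs ≤ count q xs
count-mono []       []           = z≤n
count-mono (x ∷ xs) (p⇒q ∷ p⇒qs) = +-mono-≤ (indicator-mono p⇒q) (count-mono xs p⇒qs)
  where
  indicator-mono : ∀ {a b} → (T a → T b) → indicator a ≤ indicator b
  indicator-mono {false}         _   = z≤n
  indicator-mono {true}  {true}  _   = ≤-refl
  indicator-mono {true}  {false} a⇒b = ⊥-elim (a⇒b _)

count-∨-∧ : ∀ (p q : A → Bool) xs → count p xs + count q xs ≡ count (λ x → p x ∨ q x) xs + count (λ x → p x ∧ q x) xs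
count-∨-∧ p q []       = refl
count-∨-∧ p q (x ∷ xs) = begin
  (indicator (p x) + count p xs) + (indicator (q x) + count q xs)
    ≡⟨ interchange (indicator (p x)) (count p xs) (indicator (q x)) (count q xs) ⟩
  (indicator (p x) + indicator (q x)) + (count p xs + count q xs)
    ≡⟨ cong₂ _+_ (indicator-∨-∧ (p x) (q x)) (count-∨-∧ p q xs) ⟩
  (indicator (p x ∨ q x) + indicator (p x ∧ q x)) + (count (λ x → p x ∨ q x) xs + count (λ x → p x ∧ q x) xs)
    ≡⟨ interchange (indicator (p x ∨ q x)) (indicator (p x ∧ q x)) _ _ ⟩
  (indicator (p x ∨ q x) + count (λ x → p x ∨ q x) xs) + (indicator (p x ∧ q x) + count (λ x → p x ∧ q x) xs) ∎
  where
  open ≡-Reasoning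
  interchange : ∀ a b c d → (a + b) + (c + d) ≡ (a + c) + (b + d)
  interchange = solve-∀
  indicator-∨-∧ : ∀ a b → indicator a + indicator b ≡ indicator (a ∨ b) + indicator (a ∧ b)
  indicator-∨-∧ true  b     = refl
  indicator-∨-∧ false true  = refl
  indicator-∨-∧ false false = refl

count-∨ : ∀ (p q : A → Bool) xs → count (λ x → p x ∨ q x) xs ≤ count p xs + count q xs
count-∨ p q xs = ≤-trans (m≤m+n _ _) (≤-reflexive (sym (count-∨-∧ p q xs)))

count-any≤ : ∀ (p : B → A → Bool) es xs {c} → (∀ e → count (p e) xs ≤ c) →
             count (λ x → any (λ e → p e x) es) xs ≤ length es * c
count-any≤ p []       xs p≤c = ≤-reflexive (count-false xs)
count-any≤ p (e ∷ es) xs p≤c = ≤-trans (count-∨ (p e) _ xs) (+-mono-≤ (p≤c e) (count-any≤ p es xs p≤c))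

-- Subsets and multiples

count-all-subsets : ∀ q L → count (all q) (subsets L) ≡ 2 ^ count q L
count-all-subsets q []      = refl
count-all-subsets q (x ∷ L) = begin
  count (all q) (S ++ map (x ∷_) S)                    ≡⟨ count-++ (all q) S _ ⟩
  count (all q) S + count (all q) (map (x ∷_) S)       ≡⟨ cong (count (all q) S +_) (count-map (all q) (x ∷_) S) ⟩
  count (all q) S + count (λ A → q x ∧ all q A) S      ≡⟨ cong (count (all q) S +_) (count-∧ˡ (q x) (all q) S) ⟩
  count (all q) S + indicator (q x) * count (all q) S  ≡⟨ cong (λ n → n + indicator (q x) * n) (count-all-subsets q L) ⟩
  2 ^ count q L + indicator (q x) * 2 ^ count q L      ≡⟨ doubling (q x) (2 ^ count q L) ⟩
  2 ^ indicator (q x) * 2 ^ count q L                  ≡⟨ ^-distribˡ-+-* 2 (indicator (q x)) (count q L) ⟨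
  2 ^ count q (x ∷ L)                                  ∎
  where
  open ≡-Reasoning
  S : List (List ℕ)
  S = subsets L
  doubling : ∀ b n → n + indicator b * n ≡ 2 ^ indicator b * n
  doubling true  n = refl
  doubling false n = refl

count-null-subsets : ∀ L → count null (subsets L) ≡ 1
count-null-subsets []      = refl
count-null-subsets (x ∷ L) = begin
  count null (S ++ map (x ∷_) S)                ≡⟨ count-++ null S _ ⟩
  count null S + count null (map (x ∷_) S)      ≡⟨ cong₂ _+_ (count-null-subsets L) (count-map null (x ∷_) S) ⟩
  1 + count (λ _ → false) S                     ≡⟨ cong (1 +_) (count-false S) ⟩
  1                                             ∎
  where
  open ≡-Reasoning
  S : List (List ℕ)
  S = subsets L

All-subsets : ∀ {P : ℕ → Set} {L} → All P L → All (All P) (subsets L)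
All-subsets []         = [] ∷ []
All-subsets (px ∷ pxs) = ++⁺ (All-subsets pxs) (map⁺ (All.map (px ∷_) (All-subsets pxs)))

range1-suc : ∀ m → range1 (suc m) ≡ range1 m ++ [ suc m ]
range1-suc m = trans (cong (map suc) (sym (upTo-∷ʳ m))) (map-++ suc (upTo m) [ m ])

∈-range1⁺ : ∀ {m x} → 0 < x → x ≤ m → x ∈ range1 m
∈-range1⁺ {x = suc x} _ x<m = ∈-map⁺ suc (∈-upTo⁺ x<m)

∈-range1⁻ : ∀ {m x} → x ∈ range1 m → 0 < x × x ≤ m
∈-range1⁻ x∈ with y , y∈ , refl ← ∈-map⁻ suc x∈ = s≤s z≤n , ∈-upTo⁻ y∈

count-range1-suc : ∀ (p : ℕ → Bool) m → count p (range1 (suc m)) ≡ count p (range1 m) + indicator (p (suc m))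
count-range1-suc p m = begin
  count p (range1 (suc m))                               ≡⟨ cong (count p) (range1-suc m) ⟩
  count p (range1 m ++ [ suc m ])                        ≡⟨ count-++ p (range1 m) _ ⟩
  count p (range1 m) + (indicator (p (suc m)) + 0)       ≡⟨ cong (count p (range1 m) +_) (+-identityʳ _) ⟩
  count p (range1 m) + indicator (p (suc m))             ∎
  where open ≡-Reasoning

infix 4 _∣ᵇ_

_∣ᵇ_ : ℕ → ℕ → Bool
d ∣ᵇ n = does (d ∣? n)

∣ᵇ⇒∣ : ∀ {d n} → T (d ∣ᵇ n) → d ∣ n
∣ᵇ⇒∣ {d} {n} d∣ᵇn with d ∣? n
... | yes d∣n = d∣n

∣⇒∣ᵇ : ∀ {d n} → d ∣ n → T (d ∣ᵇ n)
∣⇒∣ᵇ {d} {n} d∣n = subst T (sym (dec-true (d ∣? n) d∣n)) _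

count-multiples : ∀ d m .{{_ : NonZero d}} → count (d ∣ᵇ_) (range1 m) ≡ m / d
count-multiples d@(suc d-1) m = trans (cong (count (d ∣ᵇ_) ∘ range1) (m≡m%n+[m/n]*n m d)) (counting (m / d) (m % d) (m%n<n m d))
  where
  open ≡-Reasoning
  counting : ∀ q r → r < d → count (d ∣ᵇ_) (range1 (r + q * d)) ≡ q
  counting zero    zero    _   = refl
  counting (suc q) zero    _   = begin
    count (d ∣ᵇ_) (range1 (suc (d-1 + q * d)))
      ≡⟨ count-range1-suc (d ∣ᵇ_) _ ⟩
    count (d ∣ᵇ_) (range1 (d-1 + q * d)) + indicator (d ∣ᵇ d + q * d)
      ≡⟨ cong₂ _+_ (counting q d-1 ≤-refl) (cong indicator (dec-true (d ∣? _) (∣m∣n⇒∣m+n ∣-refl (n∣m*n q)))) ⟩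
    q + 1
      ≡⟨ +-comm q 1 ⟩
    suc q ∎
  counting q       (suc r) r<d = begin
    count (d ∣ᵇ_) (range1 (suc (r + q * d)))
      ≡⟨ count-range1-suc (d ∣ᵇ_) _ ⟩
    count (d ∣ᵇ_) (range1 (r + q * d)) + indicator (d ∣ᵇ suc r + q * d)
      ≡⟨ cong₂ _+_ (counting q r (<⇒≤ r<d)) (cong indicator (dec-false (d ∣? _) d∤)) ⟩
    q + 0
      ≡⟨ +-identityʳ q ⟩
    q ∎
    where
    d∤ : ¬ d ∣ suc r + q * d
    d∤ d∣ = <⇒≱ r<d (∣⇒≤ (∣m+n∣m⇒∣n (subst (d ∣_) (+-comm (suc r) (q * d)) d∣) (n∣m*n q)))

-- Common divisors and the subsets counted by g

∣gcdList⁺ : ∀ {d} A → All (d ∣_) A → d ∣ gcdList A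
∣gcdList⁺ []      []           = _ ∣0
∣gcdList⁺ (x ∷ A) (d∣x ∷ d∣A) = gcd-greatest d∣x (∣gcdList⁺ A d∣A)

∣gcdList⁻ : ∀ {d} A → d ∣ gcdList A → All (d ∣_) A
∣gcdList⁻ []      _    = []
∣gcdList⁻ (x ∷ A) d∣G = ∣-trans d∣G (gcd[m,n]∣m x _) ∷ ∣gcdList⁻ A (∣-trans d∣G (gcd[m,n]∣n x _))

divisibleBy : ℕ → List ℕ → Bool
divisibleBy d = all (d ∣ᵇ_)

divisibleBy⇒∣gcdList : ∀ {d} A → T (divisibleBy d A) → d ∣ gcdList A
divisibleBy⇒∣gcdList {d} A d∣ᵇA = ∣gcdList⁺ A (All.map ∣ᵇ⇒∣ (all⁺ (d ∣ᵇ_) A d∣ᵇA))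

∣gcdList⇒divisibleBy : ∀ {d} A → d ∣ gcdList A → T (divisibleBy d A)
∣gcdList⇒divisibleBy {d} A d∣G = all⁻ (d ∣ᵇ_) (All.map ∣⇒∣ᵇ (∣gcdList⁻ A d∣G))

count-divisibleBy : ∀ d m .{{_ : NonZero d}} → count (divisibleBy d) (subsets (range1 m)) ≡ 2 ^ (m / d)
count-divisibleBy d m = trans (count-all-subsets (d ∣ᵇ_) (range1 m)) (cong (2 ^_) (count-multiples d m))

hasLargeDivisor : ℕ → List ℕ → Bool
hasLargeDivisor m A = any (λ e → (5 ≤ᵇ e) ∧ divisibleBy e A) (range1 m)

count-hasLargeDivisor : ∀ m → count (hasLargeDivisor m) (subsets (range1 m)) ≤ m * 2 ^ (m / 5)
count-hasLargeDivisor m = begin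
  count (hasLargeDivisor m) S      ≤⟨ count-any≤ (λ e A → (5 ≤ᵇ e) ∧ divisibleBy e A) (range1 m) S count-e ⟩
  length (range1 m) * 2 ^ (m / 5)  ≡⟨ cong (_* 2 ^ (m / 5)) (trans (length-map suc (upTo m)) (length-upTo m)) ⟩
  m * 2 ^ (m / 5)                  ∎
  where
  open ≤-Reasoning
  S : List (List ℕ)
  S = subsets (range1 m)
  count-large : ∀ {e} → 5 ≤ e → count (divisibleBy e) S ≤ 2 ^ (m / 5)
  count-large {e} 5≤e@(s≤s _) = begin
    count (divisibleBy e) S  ≡⟨ count-divisibleBy e m ⟩
    2 ^ (m / e)              ≤⟨ ^-monoʳ-≤ 2 (/-monoʳ-≤ m 5≤e) ⟩
    2 ^ (m / 5)              ∎
  count-e : ∀ e → count (λ A → (5 ≤ᵇ e) ∧ divisibleBy e A) S ≤ 2 ^ (m / 5)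
  count-e e = begin
    count (λ A → (5 ≤ᵇ e) ∧ divisibleBy e A) S    ≡⟨ count-∧ˡ (5 ≤ᵇ e) (divisibleBy e) S ⟩
    indicator (5 ≤ᵇ e) * count (divisibleBy e) S  ≤⟨ indicator-*-≤ (count-large ∘ ≤ᵇ⇒≤ 5 e) ⟩
    2 ^ (m / 5)                                    ∎

gcdList-∷-bounds : ∀ {m x} A → x ∈ range1 m → 0 < gcdList (x ∷ A) × gcdList (x ∷ A) ≤ m
gcdList-∷-bounds {x = x} A x∈ with ∈-range1⁻ x∈
... | s≤s _ , x≤m =
  n≢0⇒n>0 (λ G≡0 → case gcd[m,n]≡0⇒m≡0 {x} {gcdList A} G≡0 of λ ()) , ≤-trans (∣⇒≤ (gcd[m,n]∣m x (gcdList A))) x≤m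

hasLargeDivisor⁺ : ∀ {m x e} A → x ∈ range1 m → 5 ≤ e → e ∣ gcdList (x ∷ A) → T (hasLargeDivisor m (x ∷ A))
hasLargeDivisor⁺ {m} {x} {e} A x∈ 5≤e e∣G =
  any⁺ (λ e → (5 ≤ᵇ e) ∧ divisibleBy e (x ∷ A))
       (lose e∈range (Equivalence.from T-∧ (≤⇒≤ᵇ 5≤e , ∣gcdList⇒divisibleBy (x ∷ A) e∣G)))
  where
  G>0 : 0 < gcdList (x ∷ A)
  G>0 = proj₁ (gcdList-∷-bounds A x∈)
  e∈range : e ∈ range1 m
  e∈range = ∈-range1⁺ (≤-trans (s≤s z≤n) 5≤e) (≤-trans (∣⇒≤ {{>-nonZero G>0}} e∣G) (proj₂ (gcdList-∷-bounds A x∈)))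

1<n⇒2∤n⇒3∤n⇒5≤n : ∀ {n} → 1 < n → ¬ 2 ∣ n → ¬ 3 ∣ n → 5 ≤ n
1<n⇒2∤n⇒3∤n⇒5≤n {1} (s≤s ()) _ _
1<n⇒2∤n⇒3∤n⇒5≤n {2} _ 2∤n _   = ⊥-elim (2∤n ∣-refl)
1<n⇒2∤n⇒3∤n⇒5≤n {3} _ _   3∤n = ⊥-elim (3∤n ∣-refl)
1<n⇒2∤n⇒3∤n⇒5≤n {4} _ 2∤n _   = ⊥-elim (2∤n (divides 2 refl))
1<n⇒2∤n⇒3∤n⇒5≤n {suc (suc (suc (suc (suc _))))} _ _ _ = s≤s (s≤s (s≤s (s≤s (s≤s z≤n))))

good⁻ : ∀ {m x} A → T (good m (x ∷ A)) → 1 < gcdList (x ∷ A) × gcd (gcdList (x ∷ A)) (suc m) ≡ 1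
good⁻ {m} {x} A goodA with 1<G , coprime ← Equivalence.to T-∧ goodA =
  toWitness {a? = 1 <? gcdList (x ∷ A)} 1<G , toWitness {a? = gcd (gcdList (x ∷ A)) (suc m) ≟ 1} coprime

good⁺ : ∀ {m x} A → 1 < gcdList (x ∷ A) → gcd (gcdList (x ∷ A)) (suc m) ≡ 1 → T (good m (x ∷ A))
good⁺ {m} {x} A 1<G coprime =
  Equivalence.from T-∧ (fromWitness {a? = 1 <? gcdList (x ∷ A)} 1<G , fromWitness {a? = gcd (gcdList (x ∷ A)) (suc m) ≟ 1} coprime)

good⇒ : ∀ {m} A → All (_∈ range1 m) A → T (good m A) →
        T (divisibleBy 2 A ∨ (not (3 ∣ᵇ suc m) ∧ divisibleBy 3 A ∨ hasLargeDivisor m A))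
good⇒ {m} (x ∷ A) (x∈ ∷ _) goodA with good⁻ {m} {x} A goodA | 2 ∣? gcdList (x ∷ A) | 3 ∣? gcdList (x ∷ A)
... | _         | yes 2∣G | _       = T-∨⁺ˡ _ (∣gcdList⇒divisibleBy (x ∷ A) 2∣G)
... | _ , coprime | no _  | yes 3∣G =
  T-∨⁺ʳ (divisibleBy 2 (x ∷ A)) (T-∨⁺ˡ _ (Equivalence.from T-∧ (3∤N , ∣gcdList⇒divisibleBy (x ∷ A) 3∣G)))
  where
  3∤N : T (not (3 ∣ᵇ suc m))
  3∤N = Equivalence.from T-not-≡ (dec-false (3 ∣? suc m) λ 3∣N →
          case ∣1⇒≡1 (subst (3 ∣_) coprime (gcd-greatest 3∣G 3∣N)) of λ ())
... | 1<G , _   | no 2∤G  | no 3∤G  =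
  T-∨⁺ʳ (divisibleBy 2 (x ∷ A)) (T-∨⁺ʳ (not (3 ∣ᵇ suc m) ∧ divisibleBy 3 (x ∷ A))
    (hasLargeDivisor⁺ A x∈ (1<n⇒2∤n⇒3∤n⇒5≤n 1<G 2∤G 3∤G) ∣-refl))

coprime-or-hasLargeDivisor : ∀ {m x} A → x ∈ range1 m → ¬ 2 ∣ suc m → ¬ 3 ∣ suc m →
                             gcd (gcdList (x ∷ A)) (suc m) ≡ 1 ⊎ T (hasLargeDivisor m (x ∷ A))
coprime-or-hasLargeDivisor {m} {x} A x∈ 2∤N 3∤N
  with gcd (gcdList (x ∷ A)) (suc m) | gcd[m,n]∣m (gcdList (x ∷ A)) (suc m) | gcd[m,n]∣n (gcdList (x ∷ A)) (suc m)
... | 0                | _   | 0∣N = case 0∣⇒≡0 0∣N of λ ()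
... | 1                | _   | _   = inj₁ refl
... | suc (suc _)      | e∣G | e∣N =
  inj₂ (hasLargeDivisor⁺ A x∈ (1<n⇒2∤n⇒3∤n⇒5≤n (s≤s (s≤s z≤n)) (λ 2∣e → 2∤N (∣-trans 2∣e e∣N))
                                                                 (λ 3∣e → 3∤N (∣-trans 3∣e e∣N)))
                              e∣G)

divisibleBy-2-or-3⇒ : ∀ {m} A → All (_∈ range1 m) A → ¬ 2 ∣ suc m → ¬ 3 ∣ suc m →
                      T (divisibleBy 2 A ∨ divisibleBy 3 A) → T (good m A ∨ (null A ∨ hasLargeDivisor m A))
divisibleBy-2-or-3⇒ []      _          _   _   _       = _
divisibleBy-2-or-3⇒ {m} (x ∷ A) (x∈ ∷ _) 2∤N 3∤N 2∨3∣A with coprime-or-hasLargeDivisor A x∈ 2∤N 3∤N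
... | inj₂ large   = T-∨⁺ʳ (good m (x ∷ A)) large
... | inj₁ coprime = T-∨⁺ˡ {good m (x ∷ A)} (null (x ∷ A) ∨ hasLargeDivisor m (x ∷ A)) (good⁺ {m} {x} A 1<G coprime)
  where
  G>0 : 0 < gcdList (x ∷ A)
  G>0 = proj₁ (gcdList-∷-bounds A x∈)
  1<G : 1 < gcdList (x ∷ A)
  1<G with Equivalence.to T-∨ 2∨3∣A
  ... | inj₁ 2∣A = ∣⇒≤ {{>-nonZero G>0}} (divisibleBy⇒∣gcdList (x ∷ A) 2∣A)
  ... | inj₂ 3∣A = ≤-trans (n≤1+n 2) (∣⇒≤ {{>-nonZero G>0}} (divisibleBy⇒∣gcdList (x ∷ A) 3∣A))

divisibleBy-2-and-3⇒6 : ∀ A → T (divisibleBy 2 A ∧ divisibleBy 3 A) → T (divisibleBy 6 A)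
divisibleBy-2-and-3⇒6 A 2∧3∣A with 2∣A , 3∣A ← Equivalence.to T-∧ 2∧3∣A =
  ∣gcdList⇒divisibleBy A (lcm-least {2} {3} (divisibleBy⇒∣gcdList A 2∣A) (divisibleBy⇒∣gcdList A 3∣A))

-- Estimates for g

error : ℕ → ℕ
error m = 2 ^ (m / 6) + suc (m * 2 ^ (m / 5))

module _ (m : ℕ) where

  private
    S : List (List ℕ)
    S = subsets (range1 m)

    S⊆range : All (All (_∈ range1 m)) S
    S⊆range = All-subsets (All.tabulate (λ x∈ → x∈))

    m*2^[m/5]≤error : m * 2 ^ (m / 5) ≤ error m
    m*2^[m/5]≤error = ≤-trans (n≤1+n _) (m≤n+m _ _)

  g≡count : g m ≡ count (good m) S
  g≡count = length-filter≡count (good m) S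

  g≤ : g m ≤ 2 ^ (m / 2) + (indicator (not (3 ∣ᵇ suc m)) * 2 ^ (m / 3) + m * 2 ^ (m / 5))
  g≤ = begin
    g m                                                                        ≡⟨ g≡count ⟩
    count (good m) S                                                           ≤⟨ count-mono S (All.map (good⇒ _) S⊆range) ⟩
    count (λ A → divisibleBy 2 A ∨ (c ∧ divisibleBy 3 A ∨ hasLargeDivisor m A)) S
      ≤⟨ ≤-trans (count-∨ (divisibleBy 2) _ S) (+-monoʳ-≤ _ (count-∨ _ (hasLargeDivisor m) S)) ⟩
    count (divisibleBy 2) S + (count (λ A → c ∧ divisibleBy 3 A) S + count (hasLargeDivisor m) S)
      ≤⟨ +-mono-≤ (≤-reflexive (count-divisibleBy 2 m)) (+-mono-≤ (≤-reflexive count-c∧3) (count-hasLargeDivisor m)) ⟩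
    2 ^ (m / 2) + (indicator c * 2 ^ (m / 3) + m * 2 ^ (m / 5))             ∎
    where
    open ≤-Reasoning
    c : Bool
    c = not (3 ∣ᵇ suc m)
    count-c∧3 : count (λ A → c ∧ divisibleBy 3 A) S ≡ indicator c * 2 ^ (m / 3)
    count-c∧3 = trans (count-∧ˡ c (divisibleBy 3) S) (cong (indicator c *_) (count-divisibleBy 3 m))

  g-upper : g m ≤ 2 ^ (m / 2) + 2 ^ (m / 3) + error m
  g-upper = begin
    g m
      ≤⟨ g≤ ⟩
    2 ^ (m / 2) + (indicator c * 2 ^ (m / 3) + m * 2 ^ (m / 5))
      ≤⟨ +-monoʳ-≤ (2 ^ (m / 2)) (+-mono-≤ (indicator-*-≤ {c} (λ _ → ≤-refl)) m*2^[m/5]≤error) ⟩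
    2 ^ (m / 2) + (2 ^ (m / 3) + error m)
      ≡⟨ +-assoc (2 ^ (m / 2)) _ _ ⟨
    2 ^ (m / 2) + 2 ^ (m / 3) + error m ∎
    where
    open ≤-Reasoning
    c : Bool
    c = not (3 ∣ᵇ suc m)

  g-upper-3∣ : 3 ∣ suc m → g m ≤ 2 ^ (m / 2) + error m
  g-upper-3∣ 3∣N = begin
    g m
      ≤⟨ g≤ ⟩
    2 ^ (m / 2) + (indicator (not (3 ∣ᵇ suc m)) * 2 ^ (m / 3) + m * 2 ^ (m / 5))
      ≡⟨ cong (λ b → 2 ^ (m / 2) + (indicator (not b) * 2 ^ (m / 3) + m * 2 ^ (m / 5))) (dec-true (3 ∣? suc m) 3∣N) ⟩
    2 ^ (m / 2) + m * 2 ^ (m / 5)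
      ≤⟨ +-monoʳ-≤ (2 ^ (m / 2)) m*2^[m/5]≤error ⟩
    2 ^ (m / 2) + error m ∎
    where open ≤-Reasoning

  g-lower : ¬ 2 ∣ suc m → ¬ 3 ∣ suc m → 2 ^ (m / 2) + 2 ^ (m / 3) ≤ g m + error m
  g-lower 2∤N 3∤N = begin
    2 ^ (m / 2) + 2 ^ (m / 3)                                      ≡⟨ cong₂ _+_ (count-divisibleBy 2 m) (count-divisibleBy 3 m) ⟨
    count (divisibleBy 2) S + count (divisibleBy 3) S             ≡⟨ count-∨-∧ (divisibleBy 2) (divisibleBy 3) S ⟩
    count (λ A → divisibleBy 2 A ∨ divisibleBy 3 A) S + count (λ A → divisibleBy 2 A ∧ divisibleBy 3 A) S
      ≤⟨ +-mono-≤ (count-mono S (All.map (λ {A} A⊆ → divisibleBy-2-or-3⇒ A A⊆ 2∤N 3∤N) S⊆range))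
                  (count-mono S (All.universal divisibleBy-2-and-3⇒6 S)) ⟩
    count (λ A → good m A ∨ (null A ∨ hasLargeDivisor m A)) S + count (divisibleBy 6) S
      ≤⟨ +-monoˡ-≤ _ (≤-trans (count-∨ (good m) _ S) (+-monoʳ-≤ _ (count-∨ null (hasLargeDivisor m) S))) ⟩
    (count (good m) S + (count null S + count (hasLargeDivisor m) S)) + count (divisibleBy 6) S
      ≤⟨ +-mono-≤ (+-mono-≤ (≤-reflexive (sym g≡count))
                            (+-mono-≤ (≤-reflexive (count-null-subsets (range1 m))) (count-hasLargeDivisor m)))
                  (≤-reflexive (count-divisibleBy 6 m)) ⟩
    (g m + suc (m * 2 ^ (m / 5))) + 2 ^ (m / 6)                     ≡⟨ +-assoc (g m) _ _ ⟩
    g m + (suc (m * 2 ^ (m / 5)) + 2 ^ (m / 6))                     ≡⟨ cong (g m +_) (+-comm _ (2 ^ (m / 6))) ⟩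
    g m + error m                                                    ∎
    where open ≤-Reasoning

-- Size of the error term

error-mono : ∀ {m n} → m ≤ n → error m ≤ error n
error-mono m≤n = +-mono-≤ (^-monoʳ-≤ 2 (/-monoˡ-≤ 6 m≤n)) (s≤s (*-mono-≤ m≤n (^-monoʳ-≤ 2 (/-monoˡ-≤ 5 m≤n))))

error≤3*m*2^[m/5] : ∀ m .{{_ : NonZero m}} → error m ≤ 3 * (m * 2 ^ (m / 5))
error≤3*m*2^[m/5] m = begin
  2 ^ (m / 6) + suc (m * y)
    ≤⟨ +-mono-≤ (≤-trans (^-monoʳ-≤ 2 (/-monoʳ-≤ m (n≤1+n 5))) (m≤n*m y m)) (+-monoˡ-≤ (m * y) 1≤m*y) ⟩
  m * y + (m * y + m * y)
    ≡⟨ cong (λ n → m * y + (m * y + n)) (+-identityʳ (m * y)) ⟨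
  3 * (m * y) ∎
  where
  open ≤-Reasoning
  y : ℕ
  y = 2 ^ (m / 5)
  1≤m*y : 1 ≤ m * y
  1≤m*y = *-mono-≤ (>-nonZero⁻¹ m) (m^n>0 2 (m / 5))

m*m≤n*n⇒m≤n : ∀ {m n} → m * m ≤ n * n → m ≤ n
m*m≤n*n⇒m≤n {m} {n} m*m≤n*n with m ≤? n
... | yes m≤n = m≤n
... | no  m≰n = ⊥-elim (<⇒≱ (*-mono-< (≰⇒> m≰n) (≰⇒> m≰n)) m*m≤n*n)

2^[k+k]≡ : ∀ k → 2 ^ (k + k) ≡ 2 ^ k * 2 ^ k
2^[k+k]≡ k = ^-distribˡ-+-* 2 k k

2^[k+k+k]≡ : ∀ k → 2 ^ (k + k + k) ≡ 2 ^ k * 2 ^ k * 2 ^ k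
2^[k+k+k]≡ k = trans (^-distribˡ-+-* 2 (k + k) k) (cong (_* 2 ^ k) (2^[k+k]≡ k))

144*[10+6k]²≤2^k : ∀ {k} → 22 ≤′ k → 144 * ((10 + 6 * k) * (10 + 6 * k)) ≤ 2 ^ k
144*[10+6k]²≤2^k ≤′-refl                    = ≤ᵇ⇒≤ _ _ _
144*[10+6k]²≤2^k (≤′-step {k} 22≤′k) = begin
  144 * ((10 + 6 * suc k) * (10 + 6 * suc k))  ≤⟨ *-monoʳ-≤ 144 (square-step (≤-trans (s≤s z≤n) (≤′⇒≤ 22≤′k))) ⟩
  144 * (2 * ((10 + 6 * k) * (10 + 6 * k)))    ≡⟨ comm ((10 + 6 * k) * (10 + 6 * k)) ⟩
  2 * (144 * ((10 + 6 * k) * (10 + 6 * k)))    ≤⟨ *-monoʳ-≤ 2 (144*[10+6k]²≤2^k 22≤′k) ⟩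
  2 * 2 ^ k                                    ∎
  where
  open ≤-Reasoning
  comm : ∀ x → 144 * (2 * x) ≡ 2 * (144 * x)
  comm = solve-∀
  identity : ∀ i → (10 + 6 * (2 + i)) * (10 + 6 * (2 + i)) + (36 * (i * i) + 120 * i + 28) ≡ 2 * ((10 + 6 * (1 + i)) * (10 + 6 * (1 + i)))
  identity = solve-∀
  square-step : ∀ {k} → 1 ≤ k → (10 + 6 * suc k) * (10 + 6 * suc k) ≤ 2 * ((10 + 6 * k) * (10 + 6 * k))
  square-step {suc i} _ = ≤-trans (m≤m+n _ (36 * (i * i) + 120 * i + 28)) (≤-reflexive (identity i))

[10+6k]/5+[10+6k]/5≤3k : ∀ {k} → 22 ≤ k → (10 + 6 * k) / 5 + (10 + 6 * k) / 5 ≤ k + k + k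
[10+6k]/5+[10+6k]/5≤3k {k} 22≤k = *-cancelˡ-≤ 5 (begin
  5 * (j + j)        ≡⟨ double-quintuple j ⟩
  2 * (j * 5)        ≤⟨ *-monoʳ-≤ 2 (m/n*n≤m (10 + 6 * k) 5) ⟩
  2 * (10 + 6 * k)   ≡⟨ distribute k ⟩
  20 + 12 * k        ≤⟨ +-monoˡ-≤ (12 * k) (≤-trans (≤-trans (n≤1+n 20) (n≤1+n 21)) (≤-trans 22≤k (m≤n*m k 3))) ⟩
  3 * k + 12 * k     ≡⟨ collect k ⟩
  5 * (k + k + k)    ∎)
  where
  open ≤-Reasoning
  j : ℕ
  j = (10 + 6 * k) / 5
  double-quintuple : ∀ j → 5 * (j + j) ≡ 2 * (j * 5)
  double-quintuple = solve-∀
  distribute : ∀ k → 2 * (10 + 6 * k) ≡ 20 + 12 * k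
  distribute = solve-∀
  collect : ∀ k → 3 * k + 12 * k ≡ 5 * (k + k + k)
  collect = solve-∀

error-bound : ∀ k → 22 ≤ k → 4 * error (10 + 6 * k) ≤ 2 ^ k * 2 ^ k
error-bound k 22≤k = begin
  4 * error M        ≤⟨ *-monoʳ-≤ 4 (error≤3*m*2^[m/5] M) ⟩
  4 * (3 * (M * y))  ≤⟨ m*m≤n*n⇒m≤n (begin
    4 * (3 * (M * y)) * (4 * (3 * (M * y)))  ≡⟨ squared M y ⟩
    144 * (M * M) * (y * y)                  ≤⟨ *-mono-≤ (144*[10+6k]²≤2^k (≤⇒≤′ 22≤k)) y²≤X³ ⟩
    X * (X * X * X)                          ≡⟨ regroup X ⟩
    X * X * (X * X)                          ∎) ⟩
  X * X              ∎
  where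
  open ≤-Reasoning
  M y X : ℕ
  M = 10 + 6 * k
  y = 2 ^ (M / 5)
  X = 2 ^ k
  squared : ∀ M y → 4 * (3 * (M * y)) * (4 * (3 * (M * y))) ≡ 144 * (M * M) * (y * y)
  squared = solve-∀
  regroup : ∀ X → X * (X * X * X) ≡ X * X * (X * X)
  regroup = solve-∀
  y²≤X³ : y * y ≤ X * X * X
  y²≤X³ = begin
    y * y                ≡⟨ ^-distribˡ-+-* 2 (M / 5) (M / 5) ⟨
    2 ^ (M / 5 + M / 5)  ≤⟨ ^-monoʳ-≤ 2 ([10+6k]/5+[10+6k]/5≤3k 22≤k) ⟩
    2 ^ (k + k + k)      ≡⟨ 2^[k+k+k]≡ k ⟩
    X * X * X            ∎

-- The comparisons at m = 6k + r

pow2-/-shift : ∀ r q d .{{_ : NonZero d}} → 2 ^ ((r + q * d) / d) ≡ 2 ^ (r / d) * 2 ^ q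
pow2-/-shift r q d = trans (cong (2 ^_) (trans (+-distrib-/-∣ʳ r (n∣m*n q)) (cong (r / d +_) (m*n/n≡m q d))))
                           (^-distribˡ-+-* 2 (r / d) q)

∣n+6k⇒∣n : ∀ {d} n k → d ∣ 6 → d ∣ n + 6 * k → d ∣ n
∣n+6k⇒∣n {d} n k d∣6 d∣n+6k = ∣m+n∣m⇒∣n (subst (d ∣_) (+-comm n (6 * k)) d∣n+6k) (∣-trans d∣6 (m∣m*n k))

∣n⇒∣n+6k : ∀ {d} n k → d ∣ 6 → d ∣ n → d ∣ n + 6 * k
∣n⇒∣n+6k n k d∣6 d∣n = ∣m∣n⇒∣m+n d∣n (∣-trans d∣6 (m∣m*n k))

cubic : ℕ → ℕ → ℕ → ℕ
cubic α β X = α * (X * X * X) + β * (X * X)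

*-<-of-quadrupled : ∀ x y u v {p q r s} → 4 * x ≤ p → 4 * y ≤ q → r ≤ 4 * u → s ≤ 4 * v → p * q < r * s → x * y < u * v
*-<-of-quadrupled x y u v {p} {q} {r} {s} 4x≤p 4y≤q r≤4u s≤4v pq<rs = *-cancelˡ-< 16 (x * y) (u * v) (begin-strict
  16 * (x * y)     ≡⟨ sixteen x y ⟩
  4 * x * (4 * y)  ≤⟨ *-mono-≤ 4x≤p 4y≤q ⟩
  p * q            <⟨ pq<rs ⟩
  r * s            ≤⟨ *-mono-≤ r≤4u s≤4v ⟩
  4 * u * (4 * v)  ≡⟨ sixteen u v ⟨
  16 * (u * v)     ∎)
  where
  open ≤-Reasoning
  sixteen : ∀ a b → 16 * (a * b) ≡ 4 * a * (4 * b)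
  sixteen = solve-∀

<-by-quartic-gap : ∀ {x y} X a b .{{_ : NonZero X}} .{{_ : NonZero a}} → x + X * X * X * X * (a + b * X) ≡ y → x < y
<-by-quartic-gap {x} X a b refl =
  m<m+n x (*-mono-≤ (*-mono-≤ (*-mono-≤ (*-mono-≤ 1≤X 1≤X) 1≤X) 1≤X) (≤-trans (>-nonZero⁻¹ a) (m≤m+n a (b * X))))
  where
  1≤X : 1 ≤ X
  1≤X = >-nonZero⁻¹ X

ca<bb-leading : ∀ X .{{_ : NonZero X}} → cubic 32 17 X * cubic 8 1 X < cubic 16 7 X * cubic 16 7 X
ca<bb-leading X = <-by-quartic-gap X 32 56 (gap X)
  where
  gap : ∀ X → (32 * (X * X * X) + 17 * (X * X)) * (8 * (X * X * X) + 1 * (X * X)) + X * X * X * X * (32 + 56 * X)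
            ≡ (16 * (X * X * X) + 7 * (X * X)) * (16 * (X * X * X) + 7 * (X * X))
  gap = solve-∀

db<cc-leading : ∀ X .{{_ : NonZero X}} → cubic 64 1 X * cubic 16 9 X < cubic 32 15 X * cubic 32 15 X
db<cc-leading X = <-by-quartic-gap X 216 368 (gap X)
  where
  gap : ∀ X → (64 * (X * X * X) + 1 * (X * X)) * (16 * (X * X * X) + 9 * (X * X)) + X * X * X * X * (216 + 368 * X)
            ≡ (32 * (X * X * X) + 15 * (X * X)) * (32 * (X * X * X) + 15 * (X * X))
  gap = solve-∀

dd<ec-leading : ∀ X .{{_ : NonZero X}} → cubic 64 1 X * cubic 64 1 X < cubic 128 31 X * cubic 32 15 X
dd<ec-leading X = <-by-quartic-gap X 464 2784 (gap X)
  where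
  gap : ∀ X → (64 * (X * X * X) + 1 * (X * X)) * (64 * (X * X * X) + 1 * (X * X)) + X * X * X * X * (464 + 2784 * X)
            ≡ (128 * (X * X * X) + 31 * (X * X)) * (32 * (X * X * X) + 15 * (X * X))
  gap = solve-∀

-- b/a > c/b > d/c < e/d with the denominators cleared.
RatioChain : ℕ → ℕ → ℕ → ℕ → ℕ → Set
RatioChain a b c d e = (c * a < b * b) × (d * b < c * c) × (d * d < e * c)

module Scale (k : ℕ) (4E≤X² : 4 * error (10 + 6 * k) ≤ 2 ^ k * 2 ^ k) where

  X : ℕ
  X = 2 ^ k

  E : ℕ
  E = error (10 + 6 * k)

  instance
    X≢0 : NonZero X
    X≢0 = m^n≢0 2 k

  2^[r+6k]/2≡ : ∀ r → 2 ^ ((r + 6 * k) / 2) ≡ 2 ^ (r / 2) * (X * X * X)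
  2^[r+6k]/2≡ r = begin
    2 ^ ((r + 6 * k) / 2)            ≡⟨ cong (λ n → 2 ^ ((r + n) / 2)) (six k) ⟩
    2 ^ ((r + (k + k + k) * 2) / 2)  ≡⟨ pow2-/-shift r (k + k + k) 2 ⟩
    2 ^ (r / 2) * 2 ^ (k + k + k)    ≡⟨ cong (2 ^ (r / 2) *_) (2^[k+k+k]≡ k) ⟩
    2 ^ (r / 2) * (X * X * X)        ∎
    where
    open ≡-Reasoning
    six : ∀ k → 6 * k ≡ (k + k + k) * 2
    six = solve-∀

  2^[r+6k]/3≡ : ∀ r → 2 ^ ((r + 6 * k) / 3) ≡ 2 ^ (r / 3) * (X * X)
  2^[r+6k]/3≡ r = begin
    2 ^ ((r + 6 * k) / 3)        ≡⟨ cong (λ n → 2 ^ ((r + n) / 3)) (six k) ⟩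
    2 ^ ((r + (k + k) * 3) / 3)  ≡⟨ pow2-/-shift r (k + k) 3 ⟩
    2 ^ (r / 3) * 2 ^ (k + k)    ≡⟨ cong (2 ^ (r / 3) *_) (2^[k+k]≡ k) ⟩
    2 ^ (r / 3) * (X * X)        ∎
    where
    open ≡-Reasoning
    six : ∀ k → 6 * k ≡ (k + k) * 3
    six = solve-∀

  leading : ℕ → ℕ
  leading r = cubic (2 ^ (r / 2)) (2 ^ (r / 3)) X

  error≤E : ∀ r → r ≤ 10 → error (r + 6 * k) ≤ E
  error≤E r r≤10 = error-mono (+-monoˡ-≤ (6 * k) r≤10)

  g-lower-at : ∀ r → r ≤ 10 → ¬ 2 ∣ suc r → ¬ 3 ∣ suc r → leading r ≤ g (r + 6 * k) + E
  g-lower-at r r≤10 2∤ 3∤ = begin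
    leading r
      ≡⟨ cong₂ _+_ (2^[r+6k]/2≡ r) (2^[r+6k]/3≡ r) ⟨
    2 ^ ((r + 6 * k) / 2) + 2 ^ ((r + 6 * k) / 3)
      ≤⟨ g-lower (r + 6 * k) (2∤ ∘ ∣n+6k⇒∣n (suc r) k (divides 3 refl)) (3∤ ∘ ∣n+6k⇒∣n (suc r) k (divides 2 refl)) ⟩
    g (r + 6 * k) + error (r + 6 * k)
      ≤⟨ +-monoʳ-≤ (g (r + 6 * k)) (error≤E r r≤10) ⟩
    g (r + 6 * k) + E ∎
    where open ≤-Reasoning

  g-upper-at : ∀ r → r ≤ 10 → g (r + 6 * k) ≤ leading r + E
  g-upper-at r r≤10 = begin
    g (r + 6 * k)
      ≤⟨ g-upper (r + 6 * k) ⟩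
    2 ^ ((r + 6 * k) / 2) + 2 ^ ((r + 6 * k) / 3) + error (r + 6 * k)
      ≤⟨ +-mono-≤ (≤-reflexive (cong₂ _+_ (2^[r+6k]/2≡ r) (2^[r+6k]/3≡ r))) (error≤E r r≤10) ⟩
    leading r + E ∎
    where open ≤-Reasoning

  g-upper-3∣-at : ∀ r → r ≤ 10 → 3 ∣ suc r → g (r + 6 * k) ≤ cubic (2 ^ (r / 2)) 0 X + E
  g-upper-3∣-at r r≤10 3∣ = begin
    g (r + 6 * k)                              ≤⟨ g-upper-3∣ (r + 6 * k) (∣n⇒∣n+6k (suc r) k (divides 2 refl) 3∣) ⟩
    2 ^ ((r + 6 * k) / 2) + error (r + 6 * k)  ≤⟨ +-mono-≤ (≤-reflexive (2^[r+6k]/2≡ r)) (error≤E r r≤10) ⟩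
    2 ^ (r / 2) * (X * X * X) + E              ≡⟨ cong (_+ E) (+-identityʳ (2 ^ (r / 2) * (X * X * X))) ⟨
    cubic (2 ^ (r / 2)) 0 X + E                ∎
    where open ≤-Reasoning

  quadruple-upper : ∀ α β {x} → x ≤ cubic α β X + E → 4 * x ≤ cubic (4 * α) (1 + 4 * β) X
  quadruple-upper α β {x} x≤ = begin
    4 * x                        ≤⟨ *-monoʳ-≤ 4 x≤ ⟩
    4 * (cubic α β X + E)        ≡⟨ *-distribˡ-+ 4 (cubic α β X) E ⟩
    4 * cubic α β X + 4 * E      ≤⟨ +-monoʳ-≤ (4 * cubic α β X) 4E≤X² ⟩
    4 * cubic α β X + X * X      ≡⟨ identity α β X ⟩
    cubic (4 * α) (1 + 4 * β) X  ∎
    where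
    open ≤-Reasoning
    identity : ∀ α β X → 4 * (α * (X * X * X) + β * (X * X)) + X * X ≡ 4 * α * (X * X * X) + (1 + 4 * β) * (X * X)
    identity = solve-∀

  quadruple-lower : ∀ α β x → cubic α (suc β) X ≤ x + E → cubic (4 * α) (3 + 4 * β) X ≤ 4 * x
  quadruple-lower α β x ≤x+E = +-cancelʳ-≤ (X * X) (cubic (4 * α) (3 + 4 * β) X) (4 * x) (begin
    cubic (4 * α) (3 + 4 * β) X + X * X  ≡⟨ identity α β X ⟩
    4 * cubic α (suc β) X                ≤⟨ *-monoʳ-≤ 4 ≤x+E ⟩
    4 * (x + E)                          ≡⟨ *-distribˡ-+ 4 x E ⟩
    4 * x + 4 * E                        ≤⟨ +-monoʳ-≤ (4 * x) 4E≤X² ⟩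
    4 * x + X * X                        ∎)
    where
    open ≤-Reasoning
    identity : ∀ α β X → 4 * α * (X * X * X) + (3 + 4 * β) * (X * X) + X * X ≡ 4 * (α * (X * X * X) + (1 + β) * (X * X))
    identity = solve-∀

  ratioChain : RatioChain (g (2 + 6 * k)) (g (4 + 6 * k)) (g (6 + 6 * k)) (g (8 + 6 * k)) (g (10 + 6 * k))
  ratioChain = ca<bb , db<cc , dd<ec
    where
    a b c d e : ℕ
    a = g (2 + 6 * k)
    b = g (4 + 6 * k)
    c = g (6 + 6 * k)
    d = g (8 + 6 * k)
    e = g (10 + 6 * k)
    -- The coefficients passed below are 2^⌊r/2⌋ and 2^⌊r/3⌋ (minus one in the lower bounds) for m = r + 6k.
    a≤ : 4 * a ≤ cubic 8 1 X
    a≤ = quadruple-upper 2 0 (g-upper-3∣-at 2 (m≤m+n 2 8) (from-yes (3 ∣? 3)))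
    b≥ : cubic 16 7 X ≤ 4 * b
    b≥ = quadruple-lower 4 1 b (g-lower-at 4 (m≤m+n 4 6) (from-no (2 ∣? 5)) (from-no (3 ∣? 5)))
    b≤ : 4 * b ≤ cubic 16 9 X
    b≤ = quadruple-upper 4 2 (g-upper-at 4 (m≤m+n 4 6))
    c≥ : cubic 32 15 X ≤ 4 * c
    c≥ = quadruple-lower 8 3 c (g-lower-at 6 (m≤m+n 6 4) (from-no (2 ∣? 7)) (from-no (3 ∣? 7)))
    c≤ : 4 * c ≤ cubic 32 17 X
    c≤ = quadruple-upper 8 4 (g-upper-at 6 (m≤m+n 6 4))
    d≤ : 4 * d ≤ cubic 64 1 X
    d≤ = quadruple-upper 16 0 (g-upper-3∣-at 8 (m≤m+n 8 2) (from-yes (3 ∣? 9)))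
    e≥ : cubic 128 31 X ≤ 4 * e
    e≥ = quadruple-lower 32 7 e (g-lower-at 10 ≤-refl (from-no (2 ∣? 11)) (from-no (3 ∣? 11)))
    ca<bb : c * a < b * b
    ca<bb = *-<-of-quadrupled c a b b c≤ a≤ b≥ b≥ (ca<bb-leading X)
    db<cc : d * b < c * c
    db<cc = *-<-of-quadrupled d b c c d≤ b≤ c≥ c≥ (db<cc-leading X)
    dd<ec : d * d < e * c
    dd<ec = *-<-of-quadrupled d d e c d≤ d≤ e≥ c≥ (dd<ec-leading X)

ratioChain-at-suc : ∀ k → 22 ≤ k → let m = 6 * suc k in RatioChain (g (m ∸ 4)) (g (m ∸ 2)) (g m) (g (m + 2)) (g (m + 4))
ratioChain-at-suc k 22≤k =
  subst (λ m → RatioChain (g (m ∸ 4)) (g (m ∸ 2)) (g m) (g (m + 2)) (g (m + 4))) (sym (*-suc 6 k))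
    (subst₂ (λ i j → RatioChain (g (2 + 6 * k)) (g (4 + 6 * k)) (g (6 + 6 * k)) (g i) (g j)) (shift 2 k) (shift 4 k)
      (Scale.ratioChain k (error-bound k 22≤k)))
  where
  shift : ∀ r k → 6 + r + 6 * k ≡ 6 + 6 * k + r
  shift r k = trans (+-assoc 6 r (6 * k)) (trans (cong (6 +_) (+-comm r (6 * k))) (sym (+-assoc 6 (6 * k) r)))

mainTheorem3 : Σ ℕ λ n₀ → NonZero n₀ × ((n : ℕ) → n ≥ n₀ →
    let a = g (6 * n ∸ 4)
        b = g (6 * n ∸ 2)
        c = g (6 * n)
        d = g (6 * n + 2)
        e = g (6 * n + 4)
    in (b * b > c * a) × (c * c > d * b) × (d * d < e * c))
mainTheorem3 = 23 , _ , λ where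
  (suc k) (s≤s 22≤k) → ratioChain-at-suc k 22≤k
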